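{- Let $k,n\in\mathbb{N}$ with $k\ge 2$ and $n\ge 3$, and let $\mathbf{G}$ be a loopless digraph (i.e., $(g,g)\notin\mathcal{E}(\mathbf{G})$ for all vertices $g$). Then $\mathrm{AIP}^k(\mathbf{G},\mathbf{K}_n)=\textsc{Yes}$.
   Context: A digraph $\mathbf{H}$ consists of a finite vertex set $\mathcal{V}(\mathbf{H})$ and an edge set $\mathcal{E}(\mathbf{H})\subseteq\mathcal{V}(\mathbf{H})^2$. $\mathbf{K}_n$ is the digraph on $\{1,\dots,n\}$ whose edges are all pairs of distinct vertices. For a set $V$ let $\binom{V}{\le k}=\{S\subseteq V:1\le|S|\le k\}$. For digraphs $\mathbf{G},\mathbf{H}$ and $k\ge 2$, introduce a variable $\lambda_S(f)$ for each $S\in\binom{\mathcal{V}(\mathbf{G})}{\le k}$ and each $f:S\to\mathcal{V}(\mathbf{H})$, and a variable $\lambda_{\mathbf{g}}(f)$ for each $\mathbf{g}=(g_1,g_2)\in\mathcal{E}(\mathbf{G})$ and each $f:\{g_1,g_2\}\to\mathcal{V}(\mathbf{H})$. The constraints are: (1) $\sum_{f:S\to\mathcal{V}(\mathbf{H})}\lambda_S(f)=1$ for every $S\in\binom{\mathcal{V}(\mathbf{G})}{\le k}$; (2) $\lambda_R(f)=\sum_{\tilde f:S\to\mathcal{V}(\mathbf{H}),\ \tilde f|_R=f}\lambda_S(\tilde f)$ for all $\emptyset\ne R\subseteq S\in\binom{\mathcal{V}(\mathbf{G})}{\le k}$ and $f:R\to\mathcal{V}(\mathbf{H})$; (3) $\lambda_R(f)=\sum_{\tilde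 f:\{g_1,g_2\}\to\mathcal{V}(\mathbf{H}),\ \tilde f|_R=f}\lambda_{\mathbf{g}}(\tilde f)$ for all $\mathbf{g}\in\mathcal{E}(\mathbf{G})$, $\emptyset\ne R\subseteq\{g_1,g_2\}$, $f:R\to\mathcal{V}(\mathbf{H})$; (4) $\lambda_{\mathbf{g}}(f)=0$ for all $\mathbf{g}\in\mathcal{E}(\mathbf{G})$ and $f:\{g_1,g_2\}\to\mathcal{V}(\mathbf{H})$ with $(f(g_1),f(g_2))\notin\mathcal{E}(\mathbf{H})$. $\mathrm{AIP}^k(\mathbf{G},\mathbf{H})=\textsc{Yes}$ iff this system has a solution in which all variables take integer values. -}

module Defs where

open import Data.Nat using (ℕ; zero; suc; _≤_)
open import Data.Bool using (Bool; true; false; not; if_then_else_)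
open import Data.Fin using (Fin)
open import Data.Fin.Properties using () renaming (_≟_ to _≟ᶠ_)
open import Data.Fin.Subset using (Subset; _⊆_; ∣_∣; ⁅_⁆; _∪_)
open import Data.Maybe using (Maybe; just; nothing; is-just)
open import Data.Vec using (Vec; []; _∷_; map; zipWith; lookup)
open import Data.List using (List; []; _∷_; concatMap; filter) renaming (map to mapL)
open import Data.Integer using (ℤ; _+_; 0ℤ; 1ℤ)
open import Data.Product using (_×_; Σ)
open import Data.Vec using (allFin)
open import Data.Vec using (toList)
open import Relation.Nullary.Decidable using (⌊_⌋)
open import Relation.Binary.PropositionalEquality using (_≡_)

record Digraph : Set where
  field
    V : ℕ
    E : Fin V → Fin V → Bool

open Digraph public

Loopless : Digraph → Set
Loopless G = ∀ (g : Fin (V G)) → E G g g ≡ false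

K : ℕ → Digraph
K n = record { V = n ; E = λ i j → not ⌊ i ≟ᶠ j ⌋ }

-- A partial map from Fin m to Fin n.  A map f : S → Fin n (S ⊆ Fin m) is
-- represented by the partial map with domain exactly S.
PMap : ℕ → ℕ → Set
PMap m n = Vec (Maybe (Fin n)) m

dom : ∀ {m n} → PMap m n → Subset m
dom f = map is-just f

restrict : ∀ {m n} → PMap m n → Subset m → PMap m n
restrict f R = zipWith (λ b x → if b then x else nothing) R f

allPMaps : (m n : ℕ) → List (PMap m n)
allPMaps zero n = [] ∷ []
allPMaps (suc m) n =
  concatMap (λ v → mapL (_∷ v) (nothing ∷ mapL just (toList (allFin n))))
            (allPMaps m n)

sumList : List ℤ → ℤ
sumList [] = 0ℤ
sumList (x ∷ xs) = x + sumList xs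

sumOver : ∀ {m n} → (PMap m n → Bool) → (PMap m n → ℤ) → ℤ
sumOver {m} {n} P w = sumList (mapL w (filter (λ f → P f Data.Bool.≟ true) (allPMaps m n)))

open import Data.Vec.Properties using (≡-dec)
open import Data.Maybe.Properties using () renaming (≡-dec to ≡-decM)

eqSub : ∀ {m} → Subset m → Subset m → Bool
eqSub S T = ⌊ ≡-dec Data.Bool._≟_ S T ⌋

eqPMap : ∀ {m n} → PMap m n → PMap m n → Bool
eqPMap f g = ⌊ ≡-dec (≡-decM _≟ᶠ_) f g ⌋

InBinom : ∀ {m} → ℕ → Subset m → Set
InBinom k S = (1 ≤ ∣ S ∣) × (∣ S ∣ ≤ k)

pair : ∀ {m} → Fin m → Fin m → Subset m
pair g₁ g₂ = ⁅ g₁ ⁆ ∪ ⁅ g₂ ⁆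

-- A solution of the AIP^k(G,H) system with integer values.
-- lam f      : the variable λ_S(f) where S = dom f
-- lamE g₁ g₂ e f : the variable λ_𝐠(f) for the edge 𝐠 = (g₁,g₂), f with dom f = {g₁,g₂}
record AIPSolution (k : ℕ) (G H : Digraph) : Set where
  field
    lam  : PMap (V G) (V H) → ℤ
    lamE : (g₁ g₂ : Fin (V G)) → E G g₁ g₂ ≡ true → PMap (V G) (V H) → ℤ
    c1 : ∀ (S : Subset (V G)) → InBinom k S →
           sumOver (λ f → eqSub (dom f) S) lam ≡ 1ℤ
    c2 : ∀ (R S : Subset (V G)) → InBinom k S → 1 ≤ ∣ R ∣ → R ⊆ S →
           ∀ (f : PMap (V G) (V H)) → dom f ≡ R →
           lam f ≡ sumOver (λ f̃ → eqSub (dom f̃) S Data.Bool.∧ eqPMap (restrict f̃ R) f) lam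
    c3 : ∀ (g₁ g₂ : Fin (V G)) (e : E G g₁ g₂ ≡ true) →
           ∀ (R : Subset (V G)) → 1 ≤ ∣ R ∣ → R ⊆ pair g₁ g₂ →
           ∀ (f : PMap (V G) (V H)) → dom f ≡ R →
           lam f ≡ sumOver (λ f̃ → eqSub (dom f̃) (pair g₁ g₂) Data.Bool.∧ eqPMap (restrict f̃ R) f)
                           (lamE g₁ g₂ e)
    c4 : ∀ (g₁ g₂ : Fin (V G)) (e : E G g₁ g₂ ≡ true) →
           ∀ (f : PMap (V G) (V H)) → dom f ≡ pair g₁ g₂ →
           ∀ (a b : Fin (V H)) → lookup f g₁ ≡ just a → lookup f g₂ ≡ just b →
           E H a b ≡ false → lamE g₁ g₂ e f ≡ 0ℤ

AIP : ℕ → Digraph → Digraph → Set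
AIP k G H = AIPSolution k G H

{-# OPTIONS --safe #-}
module Submission where

-- Choose integer 2×2 matrices T₀, …, T_{n-1} with T₀ + ⋯ + T_{n-1} = I and
-- e₁ᵀ T_c² e₁ = 0 for every colour c, and set λ_S(f) = e₁ᵀ M_{f,1} ⋯ M_{f,m} e₁,
-- where M_{f,v} = T_{f(v)} for v ∈ S and M_{f,v} = I otherwise; every edge variable
-- is λ_{g₁g₂}. Summing out a vertex replaces its factor by Σ_c T_c = I, so all the
-- marginal and normalisation constraints hold, for every k. A monochromatic edge of
-- a loopless graph contributes e₁ᵀ T_c² e₁ = 0. Three colours suffice; two do not,
-- since T₀ + T₁ = I forces (T₀)₁₁ = 1/2.

open import Defs
open import Algebra.Bundles using (CommutativeMonoid)
import Algebra.Properties.CommutativeSemigroup as CommutativeSemigroupProperties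
open import Data.Bool using (Bool; true; false; _∧_; if_then_else_) renaming (_≟_ to _≟ᵇ_)
open import Data.Bool.Properties using (∧-identityʳ; ∧-zeroʳ; ∧-commutativeMonoid)
open import Data.Empty using (⊥-elim)
open import Data.Fin using (Fin; zero; suc)
open import Data.Fin.Properties using () renaming (_≟_ to _≟ᶠ_)
open import Data.Fin.Subset using (Subset; _⊆_; _∈_; ⁅_⁆; _∪_; ∣_∣) renaming (⊥ to ∅)
open import Data.Fin.Subset.Properties using (x∈⁅y⁆⇒x≡y; x∈p∪q⁻; ∣⁅x⁆∣≡1; ∪-identityˡ; ∪-identityʳ; drop-∷-⊆; ⊥⊆)
open import Data.Integer using (ℤ; _+_; -_; 0ℤ; 1ℤ)
open import Data.Integer.Properties using (+-identityˡ; +-identityʳ; +-assoc; neg-distrib-+; +-commutativeSemigroup)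
open import Data.Integer.Tactic.RingSolver using (solve-∀)
open import Data.List using (List; []; _∷_; _++_; concatMap; filter) renaming (map to mapL)
open import Data.Maybe using (Maybe; just; nothing; is-just)
open import Data.Maybe.Properties using (just-injective) renaming (≡-dec to ≡-decM)
import Data.Maybe.Relation.Unary.All as Maybe
open import Data.Nat as ℕ using (ℕ; _≤_; s≤s)
open import Data.Nat.GeneralisedArithmetic using (fold)
open import Data.Product using (_×_; _,_; proj₁; proj₂)
open import Data.Sum using (_⊎_; [_,_]′) renaming (map to map-⊎)
open import Data.Vec using (Vec; []; _∷_; lookup; allFin; toList; tabulate; replicate; here)
open import Data.Vec.Properties using (lookup-map; lookup⇒[]=; []=⇒lookup; ∷-injective) renaming (≡-dec to ≡-decV)
open import Data.Vec.Relation.Unary.All using (All; []; _∷_)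
open import Data.Vec.Relation.Unary.All.Properties using (lookup⁻)
open import Data.Vec.Relation.Binary.Pointwise.Inductive using (Pointwise; []; _∷_)
open import Relation.Nullary.Decidable using (does; isYes; yes; no; dec-true; isYes≗does)
open import Relation.Binary.Definitions using (DecidableEquality)
open import Relation.Binary.PropositionalEquality using (_≡_; _≢_; refl; sym; trans; cong; cong₂; subst; module ≡-Reasoning)

open ≡-Reasoning
open CommutativeSemigroupProperties +-commutativeSemigroup using () renaming (interchange to +-interchange)
open CommutativeSemigroupProperties (CommutativeMonoid.commutativeSemigroup ∧-commutativeMonoid)
  using () renaming (interchange to ∧-interchange)

ℤ² : Set
ℤ² = ℤ × ℤ

0v e₁ : ℤ²
0v = 0ℤ , 0ℤ
e₁ = 1ℤ , 0ℤ

infixr 6 _⊕_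

_⊕_ : ℤ² → ℤ² → ℤ²
(a , b) ⊕ (c , d) = a + c , b + d

⊕-identityˡ : ∀ v → 0v ⊕ v ≡ v
⊕-identityˡ (a , b) = cong₂ _,_ (+-identityˡ a) (+-identityˡ b)

⊕-identityʳ : ∀ v → v ⊕ 0v ≡ v
⊕-identityʳ (a , b) = cong₂ _,_ (+-identityʳ a) (+-identityʳ b)

⊕-assoc : ∀ u v w → (u ⊕ v) ⊕ w ≡ u ⊕ (v ⊕ w)
⊕-assoc (a , b) (c , d) (e , f) = cong₂ _,_ (+-assoc a c e) (+-assoc b d f)

guard : Bool → ℤ² → ℤ²
guard true  v = v
guard false v = 0v

sumᴸ : {X : Set} → List X → (X → ℤ²) → ℤ²
sumᴸ []       h = 0v
sumᴸ (x ∷ xs) h = h x ⊕ sumᴸ xs h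

sumᴸ-cong : {X : Set} (xs : List X) {h k : X → ℤ²} → (∀ x → h x ≡ k x) → sumᴸ xs h ≡ sumᴸ xs k
sumᴸ-cong []       h≗k = refl
sumᴸ-cong (x ∷ xs) h≗k = cong₂ _⊕_ (h≗k x) (sumᴸ-cong xs h≗k)

sumᴸ-zero : {X : Set} (xs : List X) {h : X → ℤ²} → (∀ x → h x ≡ 0v) → sumᴸ xs h ≡ 0v
sumᴸ-zero []       h≗0 = refl
sumᴸ-zero (x ∷ xs) h≗0 = cong₂ _⊕_ (h≗0 x) (sumᴸ-zero xs h≗0)

sumᴸ-map : {X Y : Set} (φ : X → Y) (xs : List X) (h : Y → ℤ²) →
           sumᴸ (mapL φ xs) h ≡ sumᴸ xs (λ x → h (φ x))
sumᴸ-map φ []       h = refl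
sumᴸ-map φ (x ∷ xs) h = cong (h (φ x) ⊕_) (sumᴸ-map φ xs h)

sumᴸ-++ : {X : Set} (xs ys : List X) (h : X → ℤ²) → sumᴸ (xs ++ ys) h ≡ sumᴸ xs h ⊕ sumᴸ ys h
sumᴸ-++ []       ys h = sym (⊕-identityˡ (sumᴸ ys h))
sumᴸ-++ (x ∷ xs) ys h =
  trans (cong (h x ⊕_) (sumᴸ-++ xs ys h)) (sym (⊕-assoc (h x) (sumᴸ xs h) (sumᴸ ys h)))

sumᴸ-concatMap : {X Y : Set} (φ : X → List Y) (xs : List X) (h : Y → ℤ²) →
                 sumᴸ (concatMap φ xs) h ≡ sumᴸ xs (λ x → sumᴸ (φ x) h)
sumᴸ-concatMap φ []       h = refl
sumᴸ-concatMap φ (x ∷ xs) h =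
  trans (sumᴸ-++ (φ x) (concatMap φ xs) h) (cong (sumᴸ (φ x) h ⊕_) (sumᴸ-concatMap φ xs h))

sumᴸ-guard-∧ : {X : Set} (xs : List X) (p : X → Bool) (b : Bool) (h : X → ℤ²) →
               sumᴸ xs (λ x → guard (p x ∧ b) (h x)) ≡ guard b (sumᴸ xs (λ x → guard (p x) (h x)))
sumᴸ-guard-∧ xs p true  h = sumᴸ-cong xs (λ x → cong (λ c → guard c (h x)) (∧-identityʳ (p x)))
sumᴸ-guard-∧ xs p false h = sumᴸ-zero xs (λ x → cong (λ c → guard c (h x)) (∧-zeroʳ (p x)))

sumList-filter : {X : Set} (xs : List X) (P : X → Bool) (h : X → ℤ²) →
                 sumList (mapL (λ x → proj₁ (h x)) (filter (λ x → P x ≟ᵇ true) xs))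
                   ≡ proj₁ (sumᴸ xs (λ x → guard (P x) (h x)))
sumList-filter []       P h = refl
sumList-filter (x ∷ xs) P h with P x
... | true  = cong (proj₁ (h x) +_) (sumList-filter xs P h)
... | false = trans (sumList-filter xs P h) (sym (+-identityˡ _))

sumᶠ : ∀ {n} → (Fin n → ℤ²) → ℤ²
sumᶠ {ℕ.zero}  h = 0v
sumᶠ {ℕ.suc n} h = h zero ⊕ sumᶠ (λ c → h (suc c))

sumᶠ-0v : ∀ n → sumᶠ {n} (λ _ → 0v) ≡ 0v
sumᶠ-0v ℕ.zero    = refl
sumᶠ-0v (ℕ.suc n) = cong (0v ⊕_) (sumᶠ-0v n)

sumᶠ-indicator : ∀ {n} (d : Fin n) (h : Fin n → ℤ²) → sumᶠ (λ c → guard (does (c ≟ᶠ d)) (h c)) ≡ h d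
sumᶠ-indicator {ℕ.suc n} zero h = trans (cong (h zero ⊕_) (sumᶠ-0v n)) (⊕-identityʳ (h zero))
sumᶠ-indicator          (suc d) h = trans (⊕-identityˡ _) (sumᶠ-indicator d (λ c → h (suc c)))

sumᴸ-tabulate : {X : Set} {n : ℕ} (g : Fin n → X) (h : X → ℤ²) →
                sumᴸ (toList (tabulate g)) h ≡ sumᶠ (λ c → h (g c))
sumᴸ-tabulate {n = ℕ.zero}  g h = refl
sumᴸ-tabulate {n = ℕ.suc n} g h = cong (h (g zero) ⊕_) (sumᴸ-tabulate (λ c → g (suc c)) h)

options : (n : ℕ) → List (Maybe (Fin n))
options n = nothing ∷ mapL just (toList (allFin n))

sumᴸ-options : ∀ {n} (h : Maybe (Fin n) → ℤ²) → sumᴸ (options n) h ≡ h nothing ⊕ sumᶠ (λ c → h (just c))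
sumᴸ-options h =
  cong (h nothing ⊕_) (trans (sumᴸ-map just _ h) (sumᴸ-tabulate (λ c → c) (λ c → h (just c))))

allᵇ : ∀ {m n} → Vec (Maybe (Fin n) → Bool) m → PMap m n → Bool
allᵇ []       []      = true
allᵇ (p ∷ ps) (x ∷ f) = p x ∧ allᵇ ps f

extendsAt : ∀ {n} → Bool → Bool → Maybe (Fin n) → Maybe (Fin n) → Bool
extendsAt s r y x = does (is-just x ≟ᵇ s) ∧ does (≡-decM _≟ᶠ_ (if r then x else nothing) y)

extensionTests : ∀ {m n} → Subset m → Subset m → PMap m n → Vec (Maybe (Fin n) → Bool) m
extensionTests []      []      []      = []
extensionTests (s ∷ S) (r ∷ R) (y ∷ f) = extendsAt s r y ∷ extensionTests S R f

isYes-≡-dec-∷ : ∀ {A : Set} {m} (_≟_ : DecidableEquality A) x y (xs ys : Vec A m) →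
                isYes (≡-decV _≟_ (x ∷ xs) (y ∷ ys)) ≡ does (x ≟ y) ∧ isYes (≡-decV _≟_ xs ys)
isYes-≡-dec-∷ _≟_ x y xs ys = trans (isYes≗does _) (cong (does (x ≟ y) ∧_) (sym (isYes≗does _)))

extends⇔allᵇ : ∀ {m n} (S R : Subset m) (f f̃ : PMap m n) →
               (eqSub (dom f̃) S ∧ eqPMap (restrict f̃ R) f) ≡ allᵇ (extensionTests S R f) f̃
extends⇔allᵇ []      []      []      []      = refl
extends⇔allᵇ (s ∷ S) (r ∷ R) (y ∷ f) (x ∷ f̃) =
  begin
    eqSub (dom (x ∷ f̃)) (s ∷ S) ∧ eqPMap (restrict (x ∷ f̃) (r ∷ R)) (y ∷ f)
      ≡⟨ cong₂ _∧_ (isYes-≡-dec-∷ _≟ᵇ_ (is-just x) s (dom f̃) S)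
                   (isYes-≡-dec-∷ (≡-decM _≟ᶠ_) (if r then x else nothing) y (restrict f̃ R) f) ⟩
    (does (is-just x ≟ᵇ s) ∧ eqSub (dom f̃) S) ∧ (does (≡-decM _≟ᶠ_ (if r then x else nothing) y) ∧ eqPMap (restrict f̃ R) f)
      ≡⟨ ∧-interchange (does (is-just x ≟ᵇ s)) (eqSub (dom f̃) S) _ (eqPMap (restrict f̃ R) f) ⟩
    extendsAt s r y x ∧ (eqSub (dom f̃) S ∧ eqPMap (restrict f̃ R) f)
      ≡⟨ cong (extendsAt s r y x ∧_) (extends⇔allᵇ S R f f̃) ⟩
    extendsAt s r y x ∧ allᵇ (extensionTests S R f) f̃ ∎

∣pair∣≡2 : ∀ {m} {g₁ g₂ : Fin m} → g₁ ≢ g₂ → ∣ pair g₁ g₂ ∣ ≡ 2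
∣pair∣≡2 {g₁ = zero}   {zero}   g₁≢g₂ = ⊥-elim (g₁≢g₂ refl)
∣pair∣≡2 {g₁ = zero}   {suc j}  g₁≢g₂ = cong ℕ.suc (trans (cong ∣_∣ (∪-identityˡ ⁅ j ⁆)) (∣⁅x⁆∣≡1 j))
∣pair∣≡2 {g₁ = suc i}  {zero}   g₁≢g₂ = cong ℕ.suc (trans (cong ∣_∣ (∪-identityʳ ⁅ i ⁆)) (∣⁅x⁆∣≡1 i))
∣pair∣≡2 {g₁ = suc i}  {suc j}  g₁≢g₂ = ∣pair∣≡2 (λ i≡j → g₁≢g₂ (cong suc i≡j))

assigned⇒∈dom : ∀ {m n} (f : PMap m n) (i : Fin m) {c : Fin n} → lookup f i ≡ just c → i ∈ dom f
assigned⇒∈dom f i fi≡c = lookup⇒[]= i (dom f) (trans (lookup-map i is-just f) (cong is-just fi≡c))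

∈pair⇒≡ : ∀ {m} {g₁ g₂ i : Fin m} → i ∈ pair g₁ g₂ → i ≡ g₁ ⊎ i ≡ g₂
∈pair⇒≡ {g₁ = g₁} {g₂} i∈ = map-⊎ (x∈⁅y⁆⇒x≡y g₁) (x∈⁅y⁆⇒x≡y g₂) (x∈p∪q⁻ ⁅ g₁ ⁆ ⁅ g₂ ⁆ i∈)

pair-constant⇒monochromatic :
  ∀ {m n} (f : PMap m n) {g₁ g₂ : Fin m} {a : Fin n} → dom f ≡ pair g₁ g₂ →
  lookup f g₁ ≡ just a → lookup f g₂ ≡ just a → All (Maybe.All (_≡ a)) f
pair-constant⇒monochromatic f {g₁} {g₂} {a} df fg₁ fg₂ = lookup⁻ valueAt
  where
  valueAt : ∀ i → Maybe.All (_≡ a) (lookup f i)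
  valueAt i with lookup f i in fi
  ... | nothing = Maybe.nothing
  ... | just c  = Maybe.just ([ (λ { refl → just-injective (trans (sym fi) fg₁) })
                             , (λ { refl → just-injective (trans (sym fi) fg₂) }) ]′
                             (∈pair⇒≡ (subst (i ∈_) df (assigned⇒∈dom f i fi))))

restrict-∅ : ∀ {m n} (f : PMap m n) → restrict f ∅ ≡ replicate m nothing
restrict-∅ []      = refl
restrict-∅ (x ∷ f) = cong (nothing ∷_) (restrict-∅ f)

dom-replicate-nothing : ∀ {n} m → dom {m} {n} (replicate m nothing) ≡ ∅
dom-replicate-nothing ℕ.zero    = refl
dom-replicate-nothing (ℕ.suc m) = cong (false ∷_) (dom-replicate-nothing m)

extends-∅ : ∀ {m n} (S : Subset m) (f : PMap m n) →
            (eqSub (dom f) S ∧ eqPMap (restrict f ∅) (replicate m nothing)) ≡ eqSub (dom f) S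
extends-∅ {m} S f = begin
  eqSub (dom f) S ∧ eqPMap (restrict f ∅) (replicate m nothing)
    ≡⟨ cong (λ g → eqSub (dom f) S ∧ eqPMap g (replicate m nothing)) (restrict-∅ f) ⟩
  eqSub (dom f) S ∧ eqPMap (replicate m nothing) (replicate m nothing)
    ≡⟨ cong (eqSub (dom f) S ∧_) (trans (isYes≗does _) (dec-true (≡-decV (≡-decM _≟ᶠ_) (replicate m nothing) (replicate m nothing)) refl)) ⟩
  eqSub (dom f) S ∧ true
    ≡⟨ ∧-identityʳ _ ⟩
  eqSub (dom f) S ∎

loopless-edge⇒≢ : ∀ G → Loopless G → {g₁ g₂ : Fin (V G)} → E G g₁ g₂ ≡ true → g₁ ≢ g₂
loopless-edge⇒≢ G loopless {g₁} e refl with trans (sym e) (loopless g₁)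
... | ()

K-nonedge⇒≡ : ∀ {n} {a b : Fin n} → E (K n) a b ≡ false → a ≡ b
K-nonedge⇒≡ {a = a} {b} e with a ≟ᶠ b
... | yes a≡b = a≡b
K-nonedge⇒≡ () | no _

module TransferSolution {n : ℕ} (T : Fin n → ℤ² → ℤ²)
  (T-⊕ : ∀ c u v → T c (u ⊕ v) ≡ T c u ⊕ T c v)
  (T-0 : ∀ c → T c 0v ≡ 0v)
  (T-partition : ∀ u → sumᶠ (λ c → T c u) ≡ u)
  (T²-vanishes : ∀ c → proj₁ (T c (T c e₁)) ≡ 0ℤ)
  where

  act : Maybe (Fin n) → ℤ² → ℤ²
  act nothing  v = v
  act (just c) v = T c v

  act-sumᴸ : {X : Set} (y : Maybe (Fin n)) (xs : List X) (h : X → ℤ²) →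
             act y (sumᴸ xs h) ≡ sumᴸ xs (λ x → act y (h x))
  act-sumᴸ nothing  xs       h = refl
  act-sumᴸ (just c) []       h = T-0 c
  act-sumᴸ (just c) (x ∷ xs) h = trans (T-⊕ c (h x) (sumᴸ xs h)) (cong (T c (h x) ⊕_) (act-sumᴸ (just c) xs h))

  act-guard : ∀ y b v → act y (guard b v) ≡ guard b (act y v)
  act-guard y        true  v = refl
  act-guard nothing  false v = refl
  act-guard (just c) false v = T-0 c

  transfer : ∀ {m} → PMap m n → ℤ²
  transfer []      = e₁
  transfer (x ∷ f) = act x (transfer f)

  weight : ∀ {m} → PMap m n → ℤ
  weight f = proj₁ (transfer f)

  localSum : (Maybe (Fin n) → Bool) → ℤ² → ℤ²
  localSum p u = sumᴸ (options n) (λ x → guard (p x) (act x u))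

  localSum-split : ∀ p u → localSum p u ≡ guard (p nothing) u ⊕ sumᶠ (λ c → guard (p (just c)) (T c u))
  localSum-split p u = sumᴸ-options (λ x → guard (p x) (act x u))

  sum-transfer-factorises :
    ∀ {m} (ps : Vec (Maybe (Fin n) → Bool) m) (g : PMap m n) →
    Pointwise (λ p y → ∀ u → localSum p u ≡ act y u) ps g →
    sumᴸ (allPMaps m n) (λ f → guard (allᵇ ps f) (transfer f)) ≡ transfer g
  sum-transfer-factorises []       []      []         = refl
  sum-transfer-factorises {ℕ.suc m} (p ∷ ps) (y ∷ g) (py ∷ psg) = begin
    sumᴸ (concatMap (λ f → mapL (_∷ f) (options n)) (allPMaps m n)) H
      ≡⟨ sumᴸ-concatMap _ (allPMaps m n) H ⟩
    sumᴸ (allPMaps m n) (λ f → sumᴸ (mapL (_∷ f) (options n)) H)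
      ≡⟨ sumᴸ-cong (allPMaps m n) (λ f → trans (sumᴸ-map (_∷ f) (options n) H)
                                               (sumᴸ-guard-∧ (options n) p (allᵇ ps f) _)) ⟩
    sumᴸ (allPMaps m n) (λ f → guard (allᵇ ps f) (localSum p (transfer f)))
      ≡⟨ sumᴸ-cong (allPMaps m n) (λ f → trans (cong (guard (allᵇ ps f)) (py (transfer f)))
                                               (sym (act-guard y (allᵇ ps f) (transfer f)))) ⟩
    sumᴸ (allPMaps m n) (λ f → act y (guard (allᵇ ps f) (transfer f)))
      ≡⟨ sym (act-sumᴸ y (allPMaps m n) _) ⟩
    act y (sumᴸ (allPMaps m n) (λ f → guard (allᵇ ps f) (transfer f)))
      ≡⟨ cong (act y) (sum-transfer-factorises ps g psg) ⟩
    act y (transfer g) ∎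
    where
    H : PMap (ℕ.suc m) n → ℤ²
    H f = guard (allᵇ (p ∷ ps) f) (transfer f)

  localSum-extendsAt : ∀ s r y → (r ≡ true → s ≡ true) → is-just y ≡ r →
                       ∀ u → localSum (extendsAt s r y) u ≡ act y u
  localSum-extendsAt false false nothing _ _ u =
    trans (localSum-split (extendsAt false false nothing) u) (trans (cong (u ⊕_) (sumᶠ-0v n)) (⊕-identityʳ u))
  localSum-extendsAt true false nothing _ _ u =
    trans (localSum-split (extendsAt true false nothing) u) (trans (⊕-identityˡ _) (T-partition u))
  localSum-extendsAt true true (just d) _ _ u =
    trans (localSum-split (extendsAt true true (just d)) u) (trans (⊕-identityˡ _) (sumᶠ-indicator d (λ c → T c u)))
  localSum-extendsAt false true  y        r⇒s _  u with r⇒s refl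
  ... | ()
  localSum-extendsAt s     false (just _) _   () u
  localSum-extendsAt s     true  nothing  _   () u

  extensionTests-local : ∀ {m} (S R : Subset m) (f : PMap m n) → R ⊆ S → dom f ≡ R →
                         Pointwise (λ p y → ∀ u → localSum p u ≡ act y u) (extensionTests S R f) f
  extensionTests-local []      []      []      R⊆S df = []
  extensionTests-local (s ∷ S) (r ∷ R) (y ∷ f) R⊆S df =
    localSum-extendsAt s r y (λ { refl → []=⇒lookup (R⊆S here) }) (proj₁ (∷-injective df))
    ∷ extensionTests-local S R f (drop-∷-⊆ R⊆S) (proj₂ (∷-injective df))

  transfer-marginal : ∀ {m} (R S : Subset m) → R ⊆ S → (f : PMap m n) → dom f ≡ R →
                      sumᴸ (allPMaps m n) (λ f̃ → guard (eqSub (dom f̃) S ∧ eqPMap (restrict f̃ R) f) (transfer f̃))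
                        ≡ transfer f
  transfer-marginal {m} R S R⊆S f df =
    trans (sumᴸ-cong (allPMaps m n) (λ f̃ → cong (λ b → guard b (transfer f̃)) (extends⇔allᵇ S R f f̃)))
          (sum-transfer-factorises _ f (extensionTests-local S R f R⊆S df))

  weight-marginal : ∀ {m} (R S : Subset m) → R ⊆ S → (f : PMap m n) → dom f ≡ R →
                    weight f ≡ sumOver (λ f̃ → eqSub (dom f̃) S ∧ eqPMap (restrict f̃ R) f) weight
  weight-marginal {m} R S R⊆S f df =
    sym (trans (sumList-filter (allPMaps m n) _ transfer) (cong proj₁ (transfer-marginal R S R⊆S f df)))

  transfer-replicate-nothing : ∀ m → transfer (replicate m nothing) ≡ e₁
  transfer-replicate-nothing ℕ.zero    = refl
  transfer-replicate-nothing (ℕ.suc m) = transfer-replicate-nothing m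

  weight-normalised : ∀ {m} (S : Subset m) → sumOver (λ f → eqSub (dom f) S) weight ≡ 1ℤ
  weight-normalised {m} S = begin
    sumOver (λ f → eqSub (dom f) S) weight
      ≡⟨ sumList-filter (allPMaps m n) _ transfer ⟩
    proj₁ (sumᴸ (allPMaps m n) (λ f → guard (eqSub (dom f) S) (transfer f)))
      ≡⟨ cong proj₁ (sumᴸ-cong (allPMaps m n) (λ f → cong (λ b → guard b (transfer f)) (sym (extends-∅ S f)))) ⟩
    proj₁ (sumᴸ (allPMaps m n) (λ f → guard (eqSub (dom f) S ∧ eqPMap (restrict f ∅) ∅-map) (transfer f)))
      ≡⟨ cong proj₁ (transfer-marginal ∅ S ⊥⊆ ∅-map (dom-replicate-nothing m)) ⟩
    weight ∅-map
      ≡⟨ cong proj₁ (transfer-replicate-nothing m) ⟩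
    1ℤ ∎
    where
    ∅-map : PMap m n
    ∅-map = replicate m nothing

  transfer-monochromatic : ∀ {m} {a : Fin n} {f : PMap m n} →
                           All (Maybe.All (_≡ a)) f → transfer f ≡ fold e₁ (T a) ∣ dom f ∣
  transfer-monochromatic []                      = refl
  transfer-monochromatic (Maybe.nothing ∷ mono)  = transfer-monochromatic mono
  transfer-monochromatic (Maybe.just refl ∷ mono) = cong (T _) (transfer-monochromatic mono)

  weight-monochromatic-pair : ∀ {m} {g₁ g₂ : Fin m} {a : Fin n} (f : PMap m n) → g₁ ≢ g₂ →
                              dom f ≡ pair g₁ g₂ → lookup f g₁ ≡ just a → lookup f g₂ ≡ just a →
                              weight f ≡ 0ℤ
  weight-monochromatic-pair {a = a} f g₁≢g₂ df fg₁ fg₂ = begin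
    weight f
      ≡⟨ cong proj₁ (transfer-monochromatic (pair-constant⇒monochromatic f df fg₁ fg₂)) ⟩
    proj₁ (fold e₁ (T a) ∣ dom f ∣)
      ≡⟨ cong (λ k → proj₁ (fold e₁ (T a) k)) (trans (cong ∣_∣ df) (∣pair∣≡2 g₁≢g₂)) ⟩
    proj₁ (T a (T a e₁))
      ≡⟨ T²-vanishes a ⟩
    0ℤ ∎

  aipSolution : ∀ k G → Loopless G → AIP k G (K n)
  aipSolution k G loopless = record
    { lam  = weight
    ; lamE = λ _ _ _ → weight
    ; c1   = λ S _ → weight-normalised S
    ; c2   = λ R S _ _ R⊆S f df → weight-marginal R S R⊆S f df
    ; c3   = λ g₁ g₂ _ R _ R⊆S f df → weight-marginal R (pair g₁ g₂) R⊆S f df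
    ; c4   = λ g₁ g₂ e f df a b fg₁ fg₂ ab∉E →
               weight-monochromatic-pair f (loopless-edge⇒≢ G loopless e) df fg₁
                 (trans fg₂ (cong just (sym (K-nonedge⇒≡ ab∉E))))
    }

-- T₀ = [[1,1],[-1,-1]], T₁ = [[0,-1],[0,1]], T₂ = [[0,0],[1,1]], and T_c = 0 for c ≥ 3.
T₃ : ∀ {n} → Fin (3 ℕ.+ n) → ℤ² → ℤ²
T₃ zero                   (x , y) = x + y , - (x + y)
T₃ (suc zero)             (x , y) = - y , y
T₃ (suc (suc zero))       (x , y) = 0ℤ , x + y
T₃ (suc (suc (suc _)))    _       = 0v

T₃-⊕ : ∀ {n} (c : Fin (3 ℕ.+ n)) u v → T₃ c (u ⊕ v) ≡ T₃ c u ⊕ T₃ c v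
T₃-⊕ zero                (a , b) (c , d) =
  cong₂ _,_ (+-interchange a c b d) (trans (cong -_ (+-interchange a c b d)) (neg-distrib-+ (a + b) (c + d)))
T₃-⊕ (suc zero)          (a , b) (c , d) = cong₂ _,_ (neg-distrib-+ b d) refl
T₃-⊕ (suc (suc zero))    (a , b) (c , d) = cong₂ _,_ refl (+-interchange a c b d)
T₃-⊕ (suc (suc (suc _))) u       v       = refl

T₃-0 : ∀ {n} (c : Fin (3 ℕ.+ n)) → T₃ c 0v ≡ 0v
T₃-0 zero                = refl
T₃-0 (suc zero)          = refl
T₃-0 (suc (suc zero))    = refl
T₃-0 (suc (suc (suc _))) = refl

T₃-partition : ∀ {n} u → sumᶠ {3 ℕ.+ n} (λ c → T₃ c u) ≡ u
T₃-partition {n} (x , y) =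
  trans (cong (λ z → T₃ {n} zero (x , y) ⊕ T₃ {n} (suc zero) (x , y) ⊕ T₃ {n} (suc (suc zero)) (x , y) ⊕ z)
              (sumᶠ-0v n))
        (cong₂ _,_ (first x y) (second x y))
  where
  first : ∀ x y → (x + y) + (- y + (0ℤ + 0ℤ)) ≡ x
  first = solve-∀
  second : ∀ x y → - (x + y) + (y + ((x + y) + 0ℤ)) ≡ y
  second = solve-∀

T₃²-vanishes : ∀ {n} (c : Fin (3 ℕ.+ n)) → proj₁ (T₃ c (T₃ c e₁)) ≡ 0ℤ
T₃²-vanishes zero                = refl
T₃²-vanishes (suc zero)          = refl
T₃²-vanishes (suc (suc zero))    = refl
T₃²-vanishes (suc (suc (suc _))) = refl

proposition2p22 : (k n : ℕ) → 2 ≤ k → 3 ≤ n → (G : Digraph) → Loopless G → AIP k G (K n)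
proposition2p22 k (ℕ.suc (ℕ.suc (ℕ.suc n))) _ (s≤s (s≤s (s≤s _))) G loopless =
  TransferSolution.aipSolution (T₃ {n}) T₃-⊕ T₃-0 (T₃-partition {n}) T₃²-vanishes k G loopless
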